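{- Let $n>4$ and $\pi\in K_n$. If $[2413]\not\prec\pi$ or $[3142]\not\prec\pi$, then $\mu(\pi)=0$, where $\mu$ is the Möbius function of the poset $\mathcal{K}$.
   Context: $K_n$ is the set of permutations $\sigma\in S_n$ (one-line notation $[\sigma_1,\dots,\sigma_n]$) with $|\sigma_i-\sigma_{i-1}|\neq1$ for all $2\le i\le n$, and $\mathcal{K}=\bigcup_{n\ge1}K_n$, partially ordered by containment: $\pi\preceq\sigma$ if some subsequence of $\sigma$ is order-isomorphic to $\pi$; $\pi\prec\sigma$ means $\pi\preceq\sigma$, $\pi\ne\sigma$. The Möbius function on $\mathcal{K}$ is $\mu(\tau,\sigma)=0$ if $\tau\not\preceq\sigma$, $\mu(\sigma,\sigma)=1$, and otherwise $\mu(\tau,\sigma)=-\sum_{\pi\in\mathcal{K},\,\tau\preceq\pi\prec\sigma}\mu(\tau,\pi)$. We write $\mu(\pi)=\mu([1],\pi)$. -}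

module Defs where

open import Data.Nat using (ℕ; zero; suc; _<ᵇ_; _≡ᵇ_; _+_; _∸_)
open import Data.Bool using (Bool; true; false; _∧_; _∨_; not; if_then_else_; T)
open import Data.List using (List; []; _∷_; map; _++_; filter; length; concatMap; upTo; foldr)
open import Data.Bool.ListAction using (any)
open import Relation.Nullary.Decidable using (T?)
open import Data.Integer using (ℤ; -_) renaming (_+_ to _+ℤ_)
open import Data.Integer as Int using ()
open import Data.List.Properties using (≡-dec)
open import Data.Nat.Properties using (_≟_)
open import Relation.Nullary.Decidable using (⌊_⌋)
open import Relation.Binary.PropositionalEquality using (_≡_; _≢_)
open import Data.Product using (_×_)
open import Data.List.Relation.Binary.Permutation.Propositional using (_↭_)

-- Permutations are words in one-line notation: a list of naturals.
-- [1..n] as a list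
oneTo : ℕ → List ℕ
oneTo n = map suc (upTo n)

IsPerm : ℕ → List ℕ → Set
IsPerm n σ = σ ↭ oneTo n

_==_ : List ℕ → List ℕ → Bool
xs == ys = ⌊ ≡-dec _≟_ xs ys ⌋

notAdj : ℕ → ℕ → Bool
notAdj a b = not ((suc a ≡ᵇ b) ∨ (suc b ≡ᵇ a))

noAdjB : List ℕ → Bool
noAdjB [] = true
noAdjB (x ∷ []) = true
noAdjB (x ∷ y ∷ xs) = notAdj x y ∧ noAdjB (y ∷ xs)

InK : ℕ → List ℕ → Set
InK n σ = IsPerm n σ × T (noAdjB σ)

std : List ℕ → List ℕ
std s = map (λ x → suc (length (filter (λ y → y Data.Nat.<? x) s))) s

subseqs : List ℕ → List (List ℕ)
subseqs [] = [] ∷ []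
subseqs (x ∷ xs) = map (x ∷_) (subseqs xs) ++ subseqs xs

containsB : List ℕ → List ℕ → Bool
containsB π σ = any (λ s → std s == π) (subseqs σ)

_≼_ : List ℕ → List ℕ → Set
π ≼ σ = T (containsB π σ)

_≺_ : List ℕ → List ℕ → Set
π ≺ σ = π ≼ σ × π ≢ σ

insertAll : ℕ → List ℕ → List (List ℕ)
insertAll a [] = (a ∷ []) ∷ []
insertAll a (x ∷ xs) = (a ∷ x ∷ xs) ∷ map (x ∷_) (insertAll a xs)

perms : ℕ → List (List ℕ)
perms zero = [] ∷ []
perms (suc k) = concatMap (insertAll (suc k)) (perms k)

Klist : ℕ → List (List ℕ)
Klist k = filter (λ σ → T? (noAdjB σ)) (perms k)

KupTo : ℕ → List (List ℕ)
KupTo m = concatMap Klist (oneTo m)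

-- Möbius function with fuel (fuel = length of the upper element suffices,
-- since every π ≺ σ is strictly shorter than σ)
sumℤ : List ℤ → ℤ
sumℤ = foldr _+ℤ_ Int.0ℤ

muF : ℕ → List ℕ → List ℕ → ℤ
muF zero τ σ = if containsB τ σ ∧ (τ == σ) then Int.1ℤ else Int.0ℤ
muF (suc f) τ σ =
  if not (containsB τ σ) then Int.0ℤ else
  if τ == σ then Int.1ℤ else
  - sumℤ (map (muF f τ)
      (filter (λ π → T? (containsB τ π ∧ containsB π σ ∧ not (π == σ)))
              (KupTo (length σ))))

mobius : List ℕ → List ℕ → ℤ
mobius τ σ = muF (length σ) τ σ

μ : List ℕ → ℤ
μ π = mobius (1 ∷ []) π

module Submission where

-- A permutation of length ≥ 2 that avoids both 2413 and 3142 (a separable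
-- permutation) is a direct or skew sum of two smaller blocks, so by induction
-- it has a bond: two adjacent entries whose values are consecutive.  Elements
-- of 𝒦 have no bonds, hence every σ ∈ 𝒦 of length ≥ 2 contains 2413 or 3142,
-- and the elements of 𝒦 of length < 5 are 1, 2413 and 3142.  If π avoids one
-- of the two patterns, so does everything below it; by induction μ(σ) = 0 for
-- all σ ≺ π of length ≥ 5, and the recursion for μ(π) leaves only
-- μ(1) + μ(q) = 1 - 1, where q is the one of the two patterns that π contains.

open import Defs
open import Data.Nat
  using (ℕ; zero; suc; _+_; _<_; _≤_; _≮_; _<?_; _<ᵇ_; z≤n; s≤s; s≤s⁻¹; z<s; s<s; s<s⁻¹)
open import Data.Nat.Properties
  using ( module ≤-Reasoning; _≟_; <-isStrictTotalOrder; <-cmp; <-asym; <-irrefl; <-trans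
        ; <-≤-trans; ≤-trans; ≤-refl; ≤-reflexive; ≤-antisym; <⇒≤; ≮⇒≥; <⇒≱; ≤∧≢⇒<
        ; n<1+n; m≤m+n; <⇒<ᵇ; <ᵇ⇒<; ≡⇒≡ᵇ; suc-injective)
open import Data.Nat.Induction using (<-wellFounded)
open import Data.Integer using (ℤ; 0ℤ; 1ℤ; -1ℤ; -_) renaming (_+_ to _+ℤ_)
import Data.Integer.Properties as ℤ
open import Data.Bool using (true; false; T; _∧_; not)
open import Data.Bool.Properties using (T-≡; T-not-≡; T-∨; T-∧)
open import Data.Product using (_×_; _,_; proj₁; proj₂; uncurry; ∃-syntax)
open import Data.Sum using (_⊎_; inj₁; inj₂)
import Data.Sum as Sum
open import Data.Empty using (⊥-elim)
open import Data.List using (List; []; _∷_; [_]; _++_; map; filter; length; upTo; applyUpTo; concatMap)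
open import Data.List.Properties
  using ( ++-assoc; ++-identityʳ; map-++; map-∘; map-cong-local; map-id-local; map-upTo
        ; upTo-∷ʳ; length-map; length-upTo; filter-accept; filter-reject; ≡-dec)
open import Data.List.Membership.Propositional using (_∈_; find; lose)
open import Data.List.Membership.Propositional.Properties
  using (∈-++⁺ˡ; ∈-++⁺ʳ; ∈-++⁻; ∈-map⁺; ∈-map⁻; ∈-upTo⁺; ∈-applyUpTo⁻; ∈-concatMap⁻; ∈-filter⁻)
open import Data.List.Relation.Unary.Any using (here; there)
open import Data.List.Relation.Unary.Any.Properties using (any⁺; any⁻)
open import Data.List.Relation.Unary.All as All using (All; []; _∷_)
open import Data.List.Relation.Unary.All.Properties using (++⁺; ++⁻ʳ)
open import Data.List.Relation.Unary.AllPairs using ([]; _∷_)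
open import Data.List.Relation.Unary.Unique.Propositional using (Unique)
import Data.List.Relation.Unary.Unique.Propositional.Properties as Unique
open import Data.List.Relation.Binary.Equality.Propositional using (≋⇒≡)
open import Data.List.Relation.Binary.Sublist.Propositional
  using (_⊆_; []; _∷_; _∷ʳ_; ⊆-refl; ⊆-trans; from∈)
open import Data.List.Relation.Binary.Sublist.Propositional.Properties
  using (All-resp-⊆; Any-resp-⊆; filter⁺; length-mono-≤; to-≋; ++⁺ˡ; ++⁺ʳ)
open import Data.List.Relation.Binary.Permutation.Propositional
  using (_↭_; prep; swap; ↭-refl; ↭-sym; ↭-trans; ↭⇒↭ₛ; module PermutationReasoning)
open import Data.List.Relation.Binary.Permutation.Propositional.Properties
  using (↭-length; ∈-resp-↭; filter-↭; ∷↭∷ʳ)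
import Data.List.Relation.Binary.Permutation.Setoid.Properties as Permutationₛ
open import Function using (_∘_; flip; _⇔_; mk⇔; Equivalence)
open import Induction.WellFounded using (Acc; acc)
open import Level using (0ℓ)
open import Relation.Binary using (Rel; IsStrictTotalOrder; tri<; tri≈; tri>)
import Relation.Binary.Construct.Flip.EqAndOrd as Flip
open import Relation.Binary.PropositionalEquality
  using (_≡_; _≢_; refl; sym; trans; cong; cong₂; subst; subst₂; setoid; module ≡-Reasoning)
open import Relation.Nullary using (¬_; yes; no; contradiction)
open import Relation.Nullary.Decidable using (T?; toWitness; fromWitness)
open import Relation.Unary using (Decidable)

∈-subseqs⁺ : ∀ {t s} → t ⊆ s → t ∈ subseqs s
∈-subseqs⁺ [] = here refl
∈-subseqs⁺ {s = x ∷ s} (.x ∷ʳ t⊆s) = ∈-++⁺ʳ (map (x ∷_) (subseqs s)) (∈-subseqs⁺ t⊆s)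
∈-subseqs⁺ (refl ∷ t⊆s) = ∈-++⁺ˡ (∈-map⁺ (_ ∷_) (∈-subseqs⁺ t⊆s))

∈-subseqs⁻ : ∀ {t} s → t ∈ subseqs s → t ⊆ s
∈-subseqs⁻ [] (here refl) = []
∈-subseqs⁻ (x ∷ s) t∈ with ∈-++⁻ (map (x ∷_) (subseqs s)) t∈
... | inj₂ t∈rest = x ∷ʳ ∈-subseqs⁻ s t∈rest
... | inj₁ t∈map with _ , t′∈ , refl ← ∈-map⁻ (x ∷_) t∈map = refl ∷ ∈-subseqs⁻ s t′∈

Unique-resp-⊇ : ∀ {t s : List ℕ} → t ⊆ s → Unique s → Unique t
Unique-resp-⊇ [] [] = []
Unique-resp-⊇ (_ ∷ʳ t⊆s) (_ ∷ s!) = Unique-resp-⊇ t⊆s s!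
Unique-resp-⊇ (refl ∷ t⊆s) (x∉s ∷ s!) = All-resp-⊆ t⊆s x∉s ∷ Unique-resp-⊇ t⊆s s!

≼⁻ : ∀ {π σ} → π ≼ σ → ∃[ t ] t ⊆ σ × std t ≡ π
≼⁻ {π} {σ} π≼σ with t , t∈ , std≡ ← find (any⁻ _ (subseqs σ) π≼σ) =
  t , ∈-subseqs⁻ σ t∈ , toWitness std≡

≼⁺ : ∀ {t σ} → t ⊆ σ → std t ≼ σ
≼⁺ t⊆σ = any⁺ _ (lose (∈-subseqs⁺ t⊆σ) (fromWitness refl))

-- Ranks and standardisation

rank : List ℕ → ℕ → ℕ
rank s v = length (filter (_<? v) s)

rank-∷-< : ∀ {y v} s → y < v → rank (y ∷ s) v ≡ suc (rank s v)
rank-∷-< s y<v = cong length (filter-accept (_<? _) y<v)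

rank-∷-≮ : ∀ {y v} s → y ≮ v → rank (y ∷ s) v ≡ rank s v
rank-∷-≮ s y≮v = cong length (filter-reject (_<? _) y≮v)

rank-mono : ∀ {t s a b} → t ⊆ s → a ≤ b → rank t a ≤ rank s b
rank-mono t⊆s a≤b = length-mono-≤ (filter⁺ (_<? _) (_<? _) (λ { refl y<a → <-≤-trans y<a a≤b }) t⊆s)

rank-mono-≤ : ∀ s {a b} → a ≤ b → rank s a ≤ rank s b
rank-mono-≤ s = rank-mono (⊆-refl {x = s})

rank-cancel-< : ∀ s {a b} → rank s a < rank s b → a < b
rank-cancel-< s {a} {b} r<r with a <? b
... | yes a<b = a<b
... | no a≮b = contradiction (rank-mono-≤ s (≮⇒≥ a≮b)) (<⇒≱ r<r)

rank-mono-< : ∀ {s a b} → a ∈ s → a < b → rank s a < rank s b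
rank-mono-< {a ∷ s} {a} {b} (here refl) a<b = begin-strict
  rank (a ∷ s) a  ≡⟨ rank-∷-≮ s (<-irrefl refl) ⟩
  rank s a        ≤⟨ rank-mono-≤ s (<⇒≤ a<b) ⟩
  rank s b        <⟨ n<1+n _ ⟩
  suc (rank s b)  ≡⟨ rank-∷-< s a<b ⟨
  rank (a ∷ s) b  ∎
  where open ≤-Reasoning
rank-mono-< {y ∷ s} {a} {b} (there a∈s) a<b with y <? a
... | yes y<a rewrite rank-∷-< s y<a | rank-∷-< s (<-trans y<a a<b) = s<s (rank-mono-< a∈s a<b)
... | no y≮a = begin-strict
  rank (y ∷ s) a  ≡⟨ rank-∷-≮ s y≮a ⟩
  rank s a        <⟨ rank-mono-< a∈s a<b ⟩
  rank s b        ≤⟨ rank-mono {s} {y ∷ s} (y ∷ʳ ⊆-refl) (≤-refl {b}) ⟩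
  rank (y ∷ s) b  ∎
  where open ≤-Reasoning

rank-order : ∀ {s a b} → a ∈ s → (rank s a < rank s b ⇔ a < b)
rank-order {s} a∈s = mk⇔ (rank-cancel-< s) (rank-mono-< a∈s)

rank-map : ∀ {g : ℕ → ℕ} {b} s → (∀ {y} → y ∈ s → (g y < g b ⇔ y < b)) →
           rank (map g s) (g b) ≡ rank s b
rank-map [] _ = refl
rank-map {g} {b} (y ∷ s) g-order with y <? b
... | yes y<b = trans (rank-∷-< (map g s) (Equivalence.from (g-order (here refl)) y<b))
                      (trans (cong suc (rank-map s (g-order ∘ there))) (sym (rank-∷-< s y<b)))
... | no y≮b = trans (rank-∷-≮ (map g s) (y≮b ∘ Equivalence.to (g-order (here refl))))
                     (trans (rank-map s (g-order ∘ there)) (sym (rank-∷-≮ s y≮b)))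

std-map : ∀ {g : ℕ → ℕ} s → (∀ {y b} → y ∈ s → b ∈ s → (g y < g b ⇔ y < b)) →
          std (map g s) ≡ std s
std-map {g} s g-order = begin
  std (map g s)                            ≡⟨ map-∘ s ⟨
  map (λ b → suc (rank (map g s) (g b))) s ≡⟨ map-cong-local (All.tabulate rank-preserved) ⟩
  std s                                    ∎
  where
  open ≡-Reasoning
  rank-preserved : ∀ {b} → b ∈ s → suc (rank (map g s) (g b)) ≡ suc (rank s b)
  rank-preserved b∈s = cong suc (rank-map s (λ y∈s → g-order y∈s b∈s))

⊆map⁻ : ∀ (g : ℕ → ℕ) {t} s → t ⊆ map g s → ∃[ w ] w ⊆ s × map g w ≡ t
⊆map⁻ g [] [] = [] , [] , refl
⊆map⁻ g (y ∷ s) (_ ∷ʳ t⊆) with w , w⊆s , refl ← ⊆map⁻ g s t⊆ = w , y ∷ʳ w⊆s , refl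
⊆map⁻ g (y ∷ s) (refl ∷ t⊆) with w , w⊆s , refl ← ⊆map⁻ g s t⊆ = y ∷ w , refl ∷ w⊆s , refl

-- With σ = std v, a subsequence of σ is the image under suc ∘ rank v of a
-- subsequence w of v, and rank v is strictly monotone on the entries of v.
≼-trans : ∀ {π σ τ} → π ≼ σ → σ ≼ τ → π ≼ τ
≼-trans {π} {σ} {τ} π≼σ σ≼τ
  with v , v⊆τ , refl ← ≼⁻ {σ} {τ} σ≼τ
  with u , u⊆σ , refl ← ≼⁻ {π} π≼σ
  with w , w⊆v , refl ← ⊆map⁻ (suc ∘ rank v) v u⊆σ =
  subst (_≼ τ) (sym (std-map w rank-order-on-w)) (≼⁺ (⊆-trans w⊆v v⊆τ))
  where
  rank-order-on-w : ∀ {y b} → y ∈ w → b ∈ w → (suc (rank v y) < suc (rank v b) ⇔ y < b)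
  rank-order-on-w y∈w _ with y∈v ← Any-resp-⊆ w⊆v y∈w =
    mk⇔ (Equivalence.to (rank-order y∈v) ∘ s<s⁻¹) (s<s ∘ Equivalence.from (rank-order y∈v))

rank-zero : ∀ s → rank s 0 ≡ 0
rank-zero [] = refl
rank-zero (y ∷ s) = rank-zero s

rank-↭ : ∀ {s s′} v → s ↭ s′ → rank s v ≡ rank s′ v
rank-↭ v s↭s′ = ↭-length (filter-↭ (_<? v) s↭s′)

suc-order : ∀ {y b} → (suc y < suc b ⇔ y < b)
suc-order = mk⇔ s<s⁻¹ s<s

rank-upTo : ∀ {i k} → i ≤ k → rank (upTo k) i ≡ i
rank-upTo {zero} {k} _ = rank-zero (upTo k)
rank-upTo {suc i} {suc k} (s≤s i≤k) = begin
  rank (upTo (suc k)) (suc i)            ≡⟨ cong (λ s → rank (0 ∷ s) (suc i)) (map-upTo suc k) ⟨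
  rank (0 ∷ map suc (upTo k)) (suc i)    ≡⟨ rank-∷-< (map suc (upTo k)) z<s ⟩
  suc (rank (map suc (upTo k)) (suc i))  ≡⟨ cong suc (rank-map (upTo k) (λ _ → suc-order)) ⟩
  suc (rank (upTo k) i)                  ≡⟨ cong suc (rank-upTo i≤k) ⟩
  suc i                                  ∎
  where open ≡-Reasoning

∈-oneTo⁻ : ∀ {v k} → v ∈ oneTo k → ∃[ i ] i < k × v ≡ suc i
∈-oneTo⁻ {k = k} v∈ = ∈-applyUpTo⁻ suc (subst (_ ∈_) (map-upTo suc k) v∈)

∈-oneTo⁺ : ∀ {i k} → i < k → suc i ∈ oneTo k
∈-oneTo⁺ i<k = ∈-map⁺ suc (∈-upTo⁺ i<k)

Unique-perm : ∀ {k σ} → IsPerm k σ → Unique σ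
Unique-perm {k} σ↭ =
  Permutationₛ.Unique-resp-↭ (setoid ℕ) (↭⇒↭ₛ (↭-sym σ↭)) (Unique.map⁺ suc-injective (Unique.upTo⁺ k))

length-perm : ∀ {k σ} → IsPerm k σ → length σ ≡ k
length-perm {k} σ↭ = trans (↭-length σ↭) (trans (length-map suc (upTo k)) (length-upTo k))

std-perm : ∀ {k σ} → IsPerm k σ → std σ ≡ σ
std-perm {k} {σ} σ↭ = map-id-local (All.tabulate rank-fixed)
  where
  rank-fixed : ∀ {v} → v ∈ σ → suc (rank σ v) ≡ v
  rank-fixed v∈σ with i , i<k , refl ← ∈-oneTo⁻ (∈-resp-↭ σ↭ v∈σ) =
    cong suc (trans (rank-↭ _ σ↭) (trans (rank-map (upTo k) (λ _ → suc-order)) (rank-upTo (<⇒≤ i<k))))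

≼-perm-length< : ∀ {k σ π} → IsPerm k σ → π ≼ σ → π ≢ σ → length π < k
≼-perm-length< {k} {σ} {π} σ↭ π≼σ π≢σ with t , t⊆σ , refl ← ≼⁻ {π} {σ} π≼σ =
  ≤∧≢⇒< |std-t|≤k (π≢σ ∘ std-t≡σ)
  where
  |std-t|≡|t| : length (std t) ≡ length t
  |std-t|≡|t| = length-map _ t
  |std-t|≤k : length (std t) ≤ k
  |std-t|≤k = subst₂ _≤_ (sym |std-t|≡|t|) (length-perm σ↭) (length-mono-≤ t⊆σ)
  std-t≡σ : length (std t) ≡ k → std t ≡ σ
  std-t≡σ |std-t|≡k = begin
    std t ≡⟨ cong std (≋⇒≡ (to-≋ |t|≡|σ| t⊆σ)) ⟩
    std σ ≡⟨ std-perm σ↭ ⟩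
    σ     ∎
    where
    open ≡-Reasoning
    |t|≡|σ| : length t ≡ length σ
    |t|≡|σ| = trans (sym |std-t|≡|t|) (trans |std-t|≡k (sym (length-perm σ↭)))

p2413 p3142 : List ℕ
p2413 = 2 ∷ 4 ∷ 1 ∷ 3 ∷ []
p3142 = 3 ∷ 1 ∷ 4 ∷ 2 ∷ []

-- For the reversed order an occurrence of 2413 is an occurrence of 3142.
Occurs2413 : Rel ℕ 0ℓ → List ℕ → Set
Occurs2413 _⊏_ s = ∃[ a ] ∃[ b ] ∃[ c ] ∃[ d ] a ⊏ b × b ⊏ c × c ⊏ d × (b ∷ d ∷ a ∷ c ∷ []) ⊆ s

¬T⇒≡false : ∀ {b} → ¬ T b → b ≡ false
¬T⇒≡false {false} _ = refl
¬T⇒≡false {true} ¬t = contradiction _ ¬t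

<⇒<ᵇ≡true : ∀ {m n} → m < n → (m <ᵇ n) ≡ true
<⇒<ᵇ≡true = Equivalence.to T-≡ ∘ <⇒<ᵇ

>⇒<ᵇ≡false : ∀ {m n} → n < m → (m <ᵇ n) ≡ false
>⇒<ᵇ≡false n<m = ¬T⇒≡false (<⇒≱ n<m ∘ <⇒≤ ∘ <ᵇ⇒< _ _)

<ᵇ-irrefl : ∀ n → (n <ᵇ n) ≡ false
<ᵇ-irrefl n = ¬T⇒≡false (<-irrefl refl ∘ <ᵇ⇒< n n)

-- Row x of each rewrite table compares the entry x with all four entries;
-- the rows follow the list order because filter inspects the entries in turn.
std-2413 : ∀ {a b c d} → a < b → b < c → c < d → std (b ∷ d ∷ a ∷ c ∷ []) ≡ p2413
std-2413 a<b b<c c<d =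
  table a<b b<c c<d (<-trans a<b b<c) (<-trans b<c c<d) (<-trans a<b (<-trans b<c c<d))
  where
  table : ∀ {a b c d} → a < b → b < c → c < d → a < c → b < d → a < d →
          std (b ∷ d ∷ a ∷ c ∷ []) ≡ p2413
  table {a} {b} {c} {d} a<b b<c c<d a<c b<d a<d
    rewrite <ᵇ-irrefl b       | <⇒<ᵇ≡true b<d    | >⇒<ᵇ≡false a<b  | <⇒<ᵇ≡true b<c
          | >⇒<ᵇ≡false b<d  | <ᵇ-irrefl d      | >⇒<ᵇ≡false a<d  | >⇒<ᵇ≡false c<d
          | <⇒<ᵇ≡true a<b   | <⇒<ᵇ≡true a<d    | <ᵇ-irrefl a      | <⇒<ᵇ≡true a<c
          | >⇒<ᵇ≡false b<c  | <⇒<ᵇ≡true c<d    | >⇒<ᵇ≡false a<c  | <ᵇ-irrefl c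
    = refl

std-3142 : ∀ {a b c d} → b < a → c < b → d < c → std (b ∷ d ∷ a ∷ c ∷ []) ≡ p3142
std-3142 b<a c<b d<c =
  table b<a c<b d<c (<-trans c<b b<a) (<-trans d<c c<b) (<-trans d<c (<-trans c<b b<a))
  where
  table : ∀ {a b c d} → b < a → c < b → d < c → c < a → d < b → d < a →
          std (b ∷ d ∷ a ∷ c ∷ []) ≡ p3142
  table {a} {b} {c} {d} b<a c<b d<c c<a d<b d<a
    rewrite <ᵇ-irrefl b       | >⇒<ᵇ≡false d<b  | <⇒<ᵇ≡true b<a    | >⇒<ᵇ≡false c<b
          | <⇒<ᵇ≡true d<b   | <ᵇ-irrefl d      | <⇒<ᵇ≡true d<a    | <⇒<ᵇ≡true d<c
          | >⇒<ᵇ≡false b<a  | >⇒<ᵇ≡false d<a  | <ᵇ-irrefl a       | >⇒<ᵇ≡false c<a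
          | <⇒<ᵇ≡true c<b   | >⇒<ᵇ≡false d<c  | <⇒<ᵇ≡true c<a    | <ᵇ-irrefl c
    = refl

occurs2413⇒≼ : ∀ {s} → Occurs2413 _<_ s → p2413 ≼ s
occurs2413⇒≼ {s} (_ , _ , _ , _ , a<b , b<c , c<d , occ) = subst (_≼ s) (std-2413 a<b b<c c<d) (≼⁺ occ)

occurs3142⇒≼ : ∀ {s} → Occurs2413 (flip _<_) s → p3142 ≼ s
occurs3142⇒≼ {s} (_ , _ , _ , _ , b<a , c<b , d<c , occ) = subst (_≼ s) (std-3142 b<a c<b d<c) (≼⁺ occ)

-- Direct and skew sums

Below : Rel ℕ 0ℓ → List ℕ → List ℕ → Set
Below _⊏_ u v = All (λ x → All (x ⊏_) v) u

Decomposition : Rel ℕ 0ℓ → List ℕ → Set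
Decomposition _⊏_ s = ∃[ a ] ∃[ u ] ∃[ b ] ∃[ v ]
  s ≡ (a ∷ u) ++ (b ∷ v) × (Below _⊏_ (a ∷ u) (b ∷ v) ⊎ Below (flip _⊏_) (a ∷ u) (b ∷ v))

Separable : Rel ℕ 0ℓ → List ℕ → Set
Separable _⊏_ s = Unique s × ¬ Occurs2413 _⊏_ s × ¬ Occurs2413 (flip _⊏_) s

Occurs2413-resp-⊆ : ∀ {_⊏_ t s} → t ⊆ s → Occurs2413 _⊏_ t → Occurs2413 _⊏_ s
Occurs2413-resp-⊆ t⊆s (a , b , c , d , a⊏b , b⊏c , c⊏d , occ) =
  a , b , c , d , a⊏b , b⊏c , c⊏d , ⊆-trans occ t⊆s

Separable-resp-⊇ : ∀ {_⊏_ t s} → t ⊆ s → Separable _⊏_ s → Separable _⊏_ t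
Separable-resp-⊇ t⊆s (s! , no2413 , no3142) =
  Unique-resp-⊇ t⊆s s! , no2413 ∘ Occurs2413-resp-⊆ t⊆s , no3142 ∘ Occurs2413-resp-⊆ t⊆s

Decomposition-flip : ∀ {_⊏_ s} → Decomposition (flip _⊏_) s → Decomposition _⊏_ s
Decomposition-flip (a , u , b , v , s≡ , sum) = a , u , b , v , s≡ , Sum.swap sum

split-All-⊎ : ∀ {P Q : ℕ → Set} V → All (λ w → P w ⊎ Q w) V →
              ¬ (∃[ c ] ∃[ b ] (c ∷ b ∷ []) ⊆ V × Q c × P b) →
              ∃[ V₁ ] ∃[ V₂ ] V ≡ V₁ ++ V₂ × All P V₁ × All Q V₂
split-All-⊎ [] [] _ = [] , [] , refl , [] , []
split-All-⊎ (w ∷ V) (inj₁ Pw ∷ PQ) no-QP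
  with V₁ , V₂ , refl , P₁ , Q₂ ← split-All-⊎ V PQ (λ (c , b , cb⊆V , QP) → no-QP (c , b , w ∷ʳ cb⊆V , QP)) =
  w ∷ V₁ , V₂ , refl , Pw ∷ P₁ , Q₂
split-All-⊎ {P} {Q} (w ∷ V) (inj₂ Qw ∷ PQ) no-QP =
  [] , w ∷ V , refl , [] , Qw ∷ All.zipWith only-Q (PQ , All.tabulate not-P)
  where
  not-P : ∀ {b} → b ∈ V → ¬ P b
  not-P b∈V Pb = no-QP (w , _ , refl ∷ from∈ b∈V , Qw , Pb)
  only-Q : ∀ {b} → (P b ⊎ Q b) × ¬ P b → Q b
  only-Q (inj₁ Pb , ¬Pb) = contradiction Pb ¬Pb
  only-Q (inj₂ Qb , _) = Qb

module _ {_⊏_ : Rel ℕ 0ℓ} (⊏-sto : IsStrictTotalOrder _≡_ _⊏_) where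
  open IsStrictTotalOrder ⊏-sto using (compare) renaming (trans to ⊏-trans)

  ≢⇒⊏⊎⊐ : ∀ {x w} → x ≢ w → w ⊏ x ⊎ x ⊏ w
  ≢⇒⊏⊎⊐ {x} {w} x≢w with compare x w
  ... | tri< x⊏w _ _ = inj₂ x⊏w
  ... | tri≈ _ x≡w _ = contradiction x≡w x≢w
  ... | tri> _ _ w⊏x = inj₁ w⊏x

  decompose-around : ∀ {x a u b v} → Below _⊏_ (a ∷ u) (b ∷ v) →
    (∃[ V₁ ] ∃[ V₂ ] b ∷ v ≡ V₁ ++ V₂ × All (_⊏ x) V₁ × All (x ⊏_) V₂) →
    Decomposition _⊏_ (x ∷ (a ∷ u) ++ (b ∷ v))
  decompose-around {x} {a} {u} {b} {v} U⊏V (V₁ , [] , V≡ , V₁⊏x , []) =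
    x , [] , a , u ++ _ , refl , inj₂ (++⁺ U⊏x V⊏x ∷ [])
    where
    V⊏x : All (_⊏ x) (b ∷ v)
    V⊏x = subst (All (_⊏ x)) (sym (trans V≡ (++-identityʳ V₁))) V₁⊏x
    U⊏x : All (_⊏ x) (a ∷ u)
    U⊏x = All.map (λ y⊏V → ⊏-trans (All.head y⊏V) (All.head V⊏x)) U⊏V
  decompose-around {x} {a} {u} {b} {v} U⊏V (V₁ , b₂ ∷ v₂ , V≡ , V₁⊏x , x⊏V₂) =
    x , (a ∷ u) ++ V₁ , b₂ , v₂ , regroup , inj₁ (x⊏V₂ ∷ ++⁺ U⊏V₂ V₁⊏V₂)
    where
    regroup : x ∷ (a ∷ u) ++ (b ∷ v) ≡ (x ∷ (a ∷ u) ++ V₁) ++ (b₂ ∷ v₂)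
    regroup = cong (x ∷_) (trans (cong ((a ∷ u) ++_) V≡) (sym (++-assoc (a ∷ u) V₁ (b₂ ∷ v₂))))
    U⊏V₂ : Below _⊏_ (a ∷ u) (b₂ ∷ v₂)
    U⊏V₂ = All.map (++⁻ʳ V₁ ∘ subst (All _) V≡) U⊏V
    V₁⊏V₂ : Below _⊏_ V₁ (b₂ ∷ v₂)
    V₁⊏V₂ = All.map (λ y⊏x → All.map (⊏-trans y⊏x) x⊏V₂) V₁⊏x

  -- Since a ⊏ b′ for every entry b′ of b ∷ v, an entry c before b′ with b′ ⊏ x ⊏ c
  -- would give the 3142 x a c b′; so b ∷ v splits into a part below x and a part above x.
  decompose-∷ : ∀ {x s a u b v} → s ≡ (a ∷ u) ++ (b ∷ v) → Below _⊏_ (a ∷ u) (b ∷ v) →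
    All (x ≢_) s → ¬ Occurs2413 (flip _⊏_) (x ∷ s) → Decomposition _⊏_ (x ∷ s)
  decompose-∷ {x} {a = a} {u} {b} {v} refl U⊏V x∉s no3142 =
    decompose-around U⊏V (split-All-⊎ (b ∷ v) (All.map ≢⇒⊏⊎⊐ (++⁻ʳ (a ∷ u) x∉s)) no-3142-around-x)
    where
    no-3142-around-x : ¬ (∃[ c ] ∃[ b′ ] (c ∷ b′ ∷ []) ⊆ b ∷ v × x ⊏ c × b′ ⊏ x)
    no-3142-around-x (c , b′ , cb′⊆V , x⊏c , b′⊏x) =
      no3142 (c , x , b′ , a , x⊏c , b′⊏x , a⊏b′ , refl ∷ refl ∷ ++⁺ˡ u cb′⊆V)
      where
      a⊏b′ : a ⊏ b′
      a⊏b′ = All.lookup (All.head U⊏V) (Any-resp-⊆ cb′⊆V (there (here refl)))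

decompose : ∀ {_⊏_} → IsStrictTotalOrder _≡_ _⊏_ →
            ∀ {s} → Separable _⊏_ s → 2 ≤ length s → Decomposition _⊏_ s
decompose _ {[]} _ ()
decompose _ {_ ∷ []} _ (s≤s ())
decompose ⊏-sto {x ∷ y ∷ []} (((x≢y ∷ []) ∷ _) , _) _ with IsStrictTotalOrder.compare ⊏-sto x y
... | tri< x⊏y _ _ = x , [] , y , [] , refl , inj₁ ((x⊏y ∷ []) ∷ [])
... | tri≈ _ x≡y _ = contradiction x≡y x≢y
... | tri> _ _ y⊏x = x , [] , y , [] , refl , inj₂ ((y⊏x ∷ []) ∷ [])
decompose ⊏-sto {x ∷ s@(_ ∷ _ ∷ _)} sep@((x∉s ∷ _) , no2413 , no3142) _
  with decompose ⊏-sto (Separable-resp-⊇ (x ∷ʳ ⊆-refl) sep) (s≤s (s≤s z≤n))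
... | _ , _ , _ , _ , s≡ , inj₁ U⊏V = decompose-∷ ⊏-sto s≡ U⊏V x∉s no3142
... | _ , _ , _ , _ , s≡ , inj₂ V⊏U =
  Decomposition-flip (decompose-∷ (Flip.isStrictTotalOrder ⊏-sto) s≡ V⊏U x∉s no2413)

-- Bonds

Between : ℕ → ℕ → ℕ → Set
Between p q z = (p < z × z < q) ⊎ (q < z × z < p)

HasBond : List ℕ → Set
HasBond s = ∃[ l ] ∃[ p ] ∃[ q ] ∃[ r ] s ≡ l ++ p ∷ q ∷ r × All (¬_ ∘ Between p q) s

Between-sym : ∀ {p q z} → Between p q z → Between q p z
Between-sym = Sum.swap

¬Between-left : ∀ {p q} → ¬ Between p q p
¬Between-left (inj₁ (p<p , _)) = <-irrefl refl p<p
¬Between-left (inj₂ (_ , p<p)) = <-irrefl refl p<p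

¬Between-right : ∀ {p q} → ¬ Between p q q
¬Between-right = ¬Between-left ∘ Between-sym

above⇒¬Between : ∀ {p q z} → p < z → q < z → ¬ Between p q z
above⇒¬Between _ q<z (inj₁ (_ , z<q)) = <-asym q<z z<q
above⇒¬Between p<z _ (inj₂ (_ , z<p)) = <-asym p<z z<p

below⇒¬Between : ∀ {p q z} → z < p → z < q → ¬ Between p q z
below⇒¬Between z<p _ (inj₁ (p<z , _)) = <-asym z<p p<z
below⇒¬Between _ z<q (inj₂ (q<z , _)) = <-asym z<q q<z

¬Between-right-block : ∀ {p q U V} → p ∈ U → q ∈ U → Below _<_ U V ⊎ Below (flip _<_) U V →
                       All (¬_ ∘ Between p q) V
¬Between-right-block p∈U q∈U (inj₁ U<V) =
  All.zipWith (uncurry above⇒¬Between) (All.lookup U<V p∈U , All.lookup U<V q∈U)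
¬Between-right-block p∈U q∈U (inj₂ V<U) =
  All.zipWith (uncurry below⇒¬Between) (All.lookup V<U p∈U , All.lookup V<U q∈U)

¬Between-left-block : ∀ {p q U V} → p ∈ V → q ∈ V → Below _<_ U V ⊎ Below (flip _<_) U V →
                      All (¬_ ∘ Between p q) U
¬Between-left-block p∈V q∈V (inj₁ U<V) =
  All.map (λ y<V → below⇒¬Between (All.lookup y<V p∈V) (All.lookup y<V q∈V)) U<V
¬Between-left-block p∈V q∈V (inj₂ V<U) =
  All.map (λ V<y → above⇒¬Between (All.lookup V<y p∈V) (All.lookup V<y q∈V)) V<U

bond-++ˡ : ∀ {U V} → Below _<_ U V ⊎ Below (flip _<_) U V → HasBond U → HasBond (U ++ V)
bond-++ˡ {V = V} order (l , p , q , r , refl , nothing-between) =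
  l , p , q , r ++ V , ++-assoc l (p ∷ q ∷ r) V ,
  ++⁺ nothing-between (¬Between-right-block (∈-++⁺ʳ l (here refl)) (∈-++⁺ʳ l (there (here refl))) order)

bond-++ʳ : ∀ {U V} → Below _<_ U V ⊎ Below (flip _<_) U V → HasBond V → HasBond (U ++ V)
bond-++ʳ {U} order (l , p , q , r , refl , nothing-between) =
  U ++ l , p , q , r , sym (++-assoc U l (p ∷ q ∷ r)) ,
  ++⁺ (¬Between-left-block (∈-++⁺ʳ l (here refl)) (∈-++⁺ʳ l (there (here refl))) order) nothing-between

length-<-++ : ∀ (u : List ℕ) {b v} → length u < length (u ++ b ∷ v)
length-<-++ [] = z<s
length-<-++ (_ ∷ u) = s<s (length-<-++ u)

separable⇒bond : ∀ {s} → Separable _<_ s → 2 ≤ length s → HasBond s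
separable⇒bond {s} = go (<-wellFounded (length s))
  where
  go : ∀ {s} → Acc _<_ (length s) → Separable _<_ s → 2 ≤ length s → HasBond s
  go (acc shorter) sep 2≤|s| with decompose <-isStrictTotalOrder sep 2≤|s|
  ... | a , [] , b , [] , refl , _ = [] , a , b , [] , refl , ¬Between-left ∷ ¬Between-right ∷ []
  ... | a , a′ ∷ u , b , v , refl , order =
    bond-++ˡ order (go (shorter (length-<-++ (a ∷ a′ ∷ u) {b} {v}))
                       (Separable-resp-⊇ (++⁺ʳ (b ∷ v) ⊆-refl) sep) (s≤s (s≤s z≤n)))
  ... | a , [] , b , b′ ∷ v , refl , order =
    bond-++ʳ order (go (shorter ≤-refl) (Separable-resp-⊇ (a ∷ʳ ⊆-refl) sep) (s≤s (s≤s z≤n)))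

nothing-between⇒≡suc : ∀ {k σ p q} → IsPerm k σ → q ∈ σ → p < q → All (¬_ ∘ Between p q) σ →
                       q ≡ suc p
nothing-between⇒≡suc {σ = σ} {p} {q} σ↭ q∈σ p<q nothing-between with suc p <? q
... | no p+1≮q = ≤-antisym (≮⇒≥ p+1≮q) p<q
... | yes p+1<q with j , j<k , refl ← ∈-oneTo⁻ (∈-resp-↭ σ↭ q∈σ) =
  ⊥-elim (All.lookup nothing-between p+1∈σ (inj₁ (n<1+n p , p+1<q)))
  where
  p+1∈σ : suc p ∈ σ
  p+1∈σ = ∈-resp-↭ (↭-sym σ↭) (∈-oneTo⁺ (<-trans (s<s⁻¹ p+1<q) j<k))

consecutive⇒¬notAdj : ∀ {p q} → q ≡ suc p ⊎ p ≡ suc q → ¬ T (notAdj p q)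
consecutive⇒¬notAdj consecutive not-adjacent =
  subst T (Equivalence.to T-not-≡ not-adjacent)
        (Equivalence.from T-∨ (Sum.map (≡⇒≡ᵇ _ _ ∘ sym) (≡⇒≡ᵇ _ _ ∘ sym) consecutive))

noAdjB-tail : ∀ {x} s → T (noAdjB (x ∷ s)) → T (noAdjB s)
noAdjB-tail [] _ = _
noAdjB-tail (_ ∷ _) = proj₂ ∘ Equivalence.to T-∧

noAdjB-++ : ∀ l {p q r} → T (noAdjB (l ++ p ∷ q ∷ r)) → T (notAdj p q)
noAdjB-++ [] = proj₁ ∘ Equivalence.to T-∧
noAdjB-++ (_ ∷ l) = noAdjB-++ l ∘ noAdjB-tail (l ++ _)

InK⇒¬HasBond : ∀ {k σ} → InK k σ → ¬ HasBond σ
InK⇒¬HasBond (σ↭ , noAdj) (l , p , q , r , refl , nothing-between) with <-cmp p q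
... | tri< p<q _ _ =
  consecutive⇒¬notAdj (inj₁ (nothing-between⇒≡suc σ↭ q∈σ p<q nothing-between)) (noAdjB-++ l noAdj)
  where
  q∈σ : q ∈ l ++ p ∷ q ∷ r
  q∈σ = ∈-++⁺ʳ l (there (here refl))
... | tri> _ _ q<p =
  consecutive⇒¬notAdj (inj₂ (nothing-between⇒≡suc σ↭ p∈σ q<p (All.map (_∘ Between-sym) nothing-between)))
                      (noAdjB-++ l noAdj)
  where
  p∈σ : p ∈ l ++ p ∷ q ∷ r
  p∈σ = ∈-++⁺ʳ l (here refl)
... | tri≈ _ p≡q _ with (p≢q ∷ _) ∷ _ ← Unique-resp-⊇ (++⁺ˡ l ⊆-refl) (Unique-perm σ↭) = p≢q p≡q

K-contains-2413-or-3142 : ∀ {k σ} → InK k σ → 2 ≤ k → p2413 ≼ σ ⊎ p3142 ≼ σ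
K-contains-2413-or-3142 {k} {σ} inK@(σ↭ , _) 2≤k with T? (containsB p2413 σ) | T? (containsB p3142 σ)
... | yes σ⊇2413 | _ = inj₁ σ⊇2413
... | no _ | yes σ⊇3142 = inj₂ σ⊇3142
... | no σ⊉2413 | no σ⊉3142 =
  ⊥-elim (InK⇒¬HasBond inK (separable⇒bond separable (subst (2 ≤_) (sym (length-perm σ↭)) 2≤k)))
  where
  separable : Separable _<_ σ
  separable = Unique-perm σ↭ , σ⊉2413 ∘ occurs2413⇒≼ , σ⊉3142 ∘ occurs3142⇒≼

insertAll-↭ : ∀ {a y} z → y ∈ insertAll a z → y ↭ a ∷ z
insertAll-↭ [] (here refl) = ↭-refl
insertAll-↭ (x ∷ z) (here refl) = ↭-refl
insertAll-↭ (x ∷ z) (there y∈) with w , w∈ , refl ← ∈-map⁻ (x ∷_) y∈ =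
  ↭-trans (prep x (insertAll-↭ z w∈)) (swap x _ ↭-refl)

oneTo-suc : ∀ k → oneTo (suc k) ≡ oneTo k ++ suc k ∷ []
oneTo-suc k = trans (cong (map suc) (sym (upTo-∷ʳ k))) (map-++ suc (upTo k) (k ∷ []))

perms-↭ : ∀ k {σ} → σ ∈ perms k → IsPerm k σ
perms-↭ zero (here refl) = ↭-refl
perms-↭ (suc k) {σ} σ∈ with τ , τ∈ , σ∈ins ← find (∈-concatMap⁻ (insertAll (suc k)) {xs = perms k} σ∈) =
  begin
    σ                     ↭⟨ insertAll-↭ τ σ∈ins ⟩
    suc k ∷ τ             ↭⟨ prep (suc k) (perms-↭ k τ∈) ⟩
    suc k ∷ oneTo k       ↭⟨ ∷↭∷ʳ (suc k) (oneTo k) ⟩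
    oneTo k ++ [ suc k ]  ≡⟨ oneTo-suc k ⟨
    oneTo (suc k)         ∎
  where open PermutationReasoning

Klist⁻ : ∀ k {σ} → σ ∈ Klist k → InK k σ
Klist⁻ k σ∈ with σ∈perms , noAdj ← ∈-filter⁻ (λ σ → T? (noAdjB σ)) {xs = perms k} σ∈ =
  perms-↭ k σ∈perms , noAdj

-- By computation: K₁ = {1}, K₂ = K₃ = ∅ and K₄ = {2413, 3142}.
KupTo-4+ : ∀ r → KupTo (4 + r) ≡ (1 ∷ []) ∷ p2413 ∷ p3142 ∷ concatMap Klist (applyUpTo (5 +_) r)
KupTo-4+ r = cong (concatMap Klist) (map-upTo suc (4 + r))

∈-Klists-from-5⁻ : ∀ r {σ} → σ ∈ concatMap Klist (applyUpTo (5 +_) r) → ∃[ k ] InK k σ × 5 ≤ k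
∈-Klists-from-5⁻ r σ∈
  with k , k∈ , σ∈Kk ← find (∈-concatMap⁻ Klist {xs = applyUpTo (5 +_) r} σ∈)
  with i , _ , refl ← ∈-applyUpTo⁻ (5 +_) k∈ =
  5 + i , Klist⁻ (5 + i) σ∈Kk , m≤m+n 5 i

-- The Möbius function

==-false : ∀ {xs ys} → xs ≢ ys → (xs == ys) ≡ false
==-false {xs} {ys} xs≢ys with ≡-dec _≟_ xs ys
... | yes xs≡ys = contradiction xs≡ys xs≢ys
... | no _ = refl

[1]≼∷ : ∀ {x s} → (1 ∷ []) ≼ (x ∷ s)
[1]≼∷ {x} {s} = subst (_≼ (x ∷ s)) std[x]≡[1] (≼⁺ {x ∷ []} {x ∷ s} (from∈ (here refl)))
  where
  std[x]≡[1] : std (x ∷ []) ≡ 1 ∷ []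
  std[x]≡[1] = cong (λ n → suc n ∷ []) (rank-∷-≮ {x} {x} [] (<-irrefl refl))

interval? : (σ : List ℕ) → Decidable (λ π → T (containsB (1 ∷ []) π ∧ containsB π σ ∧ not (π == σ)))
interval? σ π = T? (containsB (1 ∷ []) π ∧ containsB π σ ∧ not (π == σ))

interval⁻ : ∀ {π σ} → T (containsB (1 ∷ []) π ∧ containsB π σ ∧ not (π == σ)) → π ≼ σ × π ≢ σ
interval⁻ {π} {σ} in-interval
  with _ , π≼σ∧π≠σ ← Equivalence.to (T-∧ {containsB (1 ∷ []) π}) in-interval
  with π≼σ , π≠σ ← Equivalence.to (T-∧ {containsB π σ}) π≼σ∧π≠σ =
  π≼σ , λ π≡σ → subst T (Equivalence.to T-not-≡ π≠σ) (fromWitness {a? = ≡-dec _≟_ π σ} π≡σ)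

shorter⇒≢ : ∀ {π σ : List ℕ} → length π < length σ → π ≢ σ
shorter⇒≢ |π|<|σ| π≡σ = <-irrefl (cong length π≡σ) |π|<|σ|

μ-unfold : ∀ f {σ} → 2 ≤ length σ →
  muF (suc f) (1 ∷ []) σ ≡ - sumℤ (map (muF f (1 ∷ [])) (filter (interval? σ) (KupTo (length σ))))
μ-unfold f {[]} ()
μ-unfold f {_ ∷ []} (s≤s ())
μ-unfold f {x ∷ y ∷ s} _
  rewrite Equivalence.to T-≡ ([1]≼∷ {x} {y ∷ s})
        | ==-false (shorter⇒≢ {1 ∷ []} {x ∷ y ∷ s} (s≤s (s≤s z≤n)))
  = refl

μ-[1] : ∀ f → muF f (1 ∷ []) (1 ∷ []) ≡ 1ℤ
μ-[1] zero = refl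
μ-[1] (suc f) = refl

μ-2413 : ∀ f → muF (suc f) (1 ∷ []) p2413 ≡ -1ℤ
μ-2413 f rewrite μ-[1] f = refl

μ-3142 : ∀ f → muF (suc f) (1 ∷ []) p3142 ≡ -1ℤ
μ-3142 f rewrite μ-[1] f = refl

sumℤ-[1]-cancel : ∀ f q Π → muF (suc f) (1 ∷ []) q ≡ -1ℤ →
  sumℤ (map (muF (suc f) (1 ∷ [])) ((1 ∷ []) ∷ q ∷ Π)) ≡ sumℤ (map (muF (suc f) (1 ∷ [])) Π)
sumℤ-[1]-cancel f q Π μq rewrite μ-[1] (suc f) | μq =
  trans (sym (ℤ.+-assoc 1ℤ -1ℤ S)) (ℤ.+-identityˡ S)
  where
  S : ℤ
  S = sumℤ (map (muF (suc f) (1 ∷ [])) Π)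

sumℤ-zero : ∀ {g : List ℕ → ℤ} {Π} → All (λ π → g π ≡ 0ℤ) Π → sumℤ (map g Π) ≡ 0ℤ
sumℤ-zero [] = refl
sumℤ-zero (g≡0 ∷ rest) = cong₂ _+ℤ_ g≡0 (sumℤ-zero rest)

sumℤ-interval-prefix : ∀ f {σ} Π → 5 ≤ length σ →
  (p2413 ≼ σ × ¬ p3142 ≼ σ) ⊎ (¬ p2413 ≼ σ × p3142 ≼ σ) →
  sumℤ (map (muF (suc f) (1 ∷ [])) (filter (interval? σ) ((1 ∷ []) ∷ p2413 ∷ p3142 ∷ Π)))
    ≡ sumℤ (map (muF (suc f) (1 ∷ [])) (filter (interval? σ) Π))
sumℤ-interval-prefix f {x ∷ s} Π (s≤s 4≤|s|) (inj₁ (σ⊇2413 , σ⊉3142))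
  rewrite Equivalence.to T-≡ ([1]≼∷ {x} {s})
        | ==-false (shorter⇒≢ {1 ∷ []} {x ∷ s} (s≤s (≤-trans (s≤s z≤n) 4≤|s|)))
        | Equivalence.to T-≡ σ⊇2413 | ==-false (shorter⇒≢ {p2413} {x ∷ s} (s≤s 4≤|s|))
        | ¬T⇒≡false σ⊉3142
  = sumℤ-[1]-cancel f p2413 (filter (interval? (x ∷ s)) Π) (μ-2413 f)
sumℤ-interval-prefix f {x ∷ s} Π (s≤s 4≤|s|) (inj₂ (σ⊉2413 , σ⊇3142))
  rewrite Equivalence.to T-≡ ([1]≼∷ {x} {s})
        | ==-false (shorter⇒≢ {1 ∷ []} {x ∷ s} (s≤s (≤-trans (s≤s z≤n) 4≤|s|)))
        | ¬T⇒≡false σ⊉2413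
        | Equivalence.to T-≡ σ⊇3142 | ==-false (shorter⇒≢ {p3142} {x ∷ s} (s≤s 4≤|s|))
  = sumℤ-[1]-cancel f p3142 (filter (interval? (x ∷ s)) Π) (μ-3142 f)

¬≺⇒¬≼ : ∀ {π σ} → π ≢ σ → ¬ π ≺ σ → ¬ π ≼ σ
¬≺⇒¬≼ π≢σ π⊀σ π≼σ = π⊀σ (π≼σ , π≢σ)

Avoids2413or3142 : List ℕ → Set
Avoids2413or3142 σ = ¬ p2413 ≼ σ ⊎ ¬ p3142 ≼ σ

Avoids-≼ : ∀ {π σ} → π ≼ σ → Avoids2413or3142 σ → Avoids2413or3142 π
Avoids-≼ {π} {σ} π≼σ = Sum.map (λ σ⊉p p≼π → σ⊉p (≼-trans {p2413} {π} {σ} p≼π π≼σ))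
                               (λ σ⊉p p≼π → σ⊉p (≼-trans {p3142} {π} {σ} p≼π π≼σ))

exactly-one : ∀ {A B : Set} → A ⊎ B → ¬ A ⊎ ¬ B → (A × ¬ B) ⊎ (¬ A × B)
exactly-one (inj₁ a) (inj₁ ¬a) = contradiction a ¬a
exactly-one (inj₁ a) (inj₂ ¬b) = inj₁ (a , ¬b)
exactly-one (inj₂ b) (inj₁ ¬a) = inj₂ (¬a , b)
exactly-one (inj₂ b) (inj₂ ¬b) = contradiction b ¬b

interval-tail-vanishes : ∀ {f m σ} r → InK m σ → m ≤ suc f → Avoids2413or3142 σ →
  (∀ {k π} → InK k π → 5 ≤ k → k ≤ f → Avoids2413or3142 π → muF f (1 ∷ []) π ≡ 0ℤ) →
  All (λ π → muF f (1 ∷ []) π ≡ 0ℤ) (filter (interval? σ) (concatMap Klist (applyUpTo (5 +_) r)))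
interval-tail-vanishes {f} {m} {σ} r (σ↭ , _) m≤1+f avoid μ-vanishes-below = All.tabulate vanishes
  where
  Π₅ : List (List ℕ)
  Π₅ = concatMap Klist (applyUpTo (5 +_) r)
  vanishes : ∀ {π} → π ∈ filter (interval? σ) Π₅ → muF f (1 ∷ []) π ≡ 0ℤ
  vanishes {π} π∈
    with π∈K , in-interval ← ∈-filter⁻ (interval? σ) {xs = Π₅} π∈
    with k , inK-π@(π↭ , _) , 5≤k ← ∈-Klists-from-5⁻ r π∈K
    with π≼σ , π≢σ ← interval⁻ {π} {σ} in-interval =
    μ-vanishes-below inK-π 5≤k (s≤s⁻¹ (≤-trans k<m m≤1+f)) (Avoids-≼ {π} {σ} π≼σ avoid)
    where
    k<m : k < m
    k<m = subst (_< m) (length-perm π↭) (≼-perm-length< σ↭ π≼σ π≢σ)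

μ-vanishes : ∀ f {m σ} → InK m σ → 5 ≤ m → m ≤ f → Avoids2413or3142 σ → muF f (1 ∷ []) σ ≡ 0ℤ
μ-vanishes zero _ (s≤s _) () _
μ-vanishes (suc zero) _ (s≤s (s≤s _)) (s≤s ()) _
μ-vanishes (suc (suc f)) {suc (suc (suc (suc r)))} {σ} inK@(σ↭ , _) 5≤m@(s≤s (s≤s (s≤s (s≤s _)))) m≤2+f avoid =
  begin
    muF (suc (suc f)) (1 ∷ []) σ                 ≡⟨ μ-unfold (suc f) {σ} 2≤|σ| ⟩
    - sum-below (KupTo (length σ))               ≡⟨ cong (-_ ∘ sum-below) KupTo|σ|≡ ⟩
    - sum-below ((1 ∷ []) ∷ p2413 ∷ p3142 ∷ Π₅)  ≡⟨ cong -_ prefix-cancels ⟩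
    - sum-below Π₅
      ≡⟨ cong -_ (sumℤ-zero (interval-tail-vanishes r inK m≤2+f avoid (μ-vanishes (suc f)))) ⟩
    0ℤ                                           ∎
  where
  open ≡-Reasoning
  μ′ : List ℕ → ℤ
  μ′ = muF (suc f) (1 ∷ [])
  sum-below : List (List ℕ) → ℤ
  sum-below Π = sumℤ (map μ′ (filter (interval? σ) Π))
  Π₅ : List (List ℕ)
  Π₅ = concatMap Klist (applyUpTo (5 +_) r)
  5≤|σ| : 5 ≤ length σ
  5≤|σ| = subst (5 ≤_) (sym (length-perm σ↭)) 5≤m
  2≤|σ| : 2 ≤ length σ
  2≤|σ| = ≤-trans (s≤s (s≤s z≤n)) 5≤|σ|
  KupTo|σ|≡ : KupTo (length σ) ≡ (1 ∷ []) ∷ p2413 ∷ p3142 ∷ Π₅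
  KupTo|σ|≡ = trans (cong KupTo (length-perm σ↭)) (KupTo-4+ r)
  contains : p2413 ≼ σ ⊎ p3142 ≼ σ
  contains = K-contains-2413-or-3142 inK (≤-trans (s≤s (s≤s z≤n)) 5≤m)
  prefix-cancels : sum-below ((1 ∷ []) ∷ p2413 ∷ p3142 ∷ Π₅) ≡ sum-below Π₅
  prefix-cancels = sumℤ-interval-prefix f {σ} Π₅ 5≤|σ| (exactly-one contains avoid)

mainTheorem12 : (n : ℕ) (π : List ℕ) → 4 < n → InK n π →
    (¬ ((2 ∷ 4 ∷ 1 ∷ 3 ∷ []) ≺ π) ⊎ ¬ ((3 ∷ 1 ∷ 4 ∷ 2 ∷ []) ≺ π)) →
    μ π ≡ 0ℤ
mainTheorem12 n π 4<n inK@(π↭ , _) avoids =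
  μ-vanishes (length π) inK 4<n (≤-reflexive (sym (length-perm π↭)))
    (Sum.map (¬≺⇒¬≼ (shorter⇒≢ {p2413} {π} 4<|π|)) (¬≺⇒¬≼ (shorter⇒≢ {p3142} {π} 4<|π|)) avoids)
  where
  4<|π| : 4 < length π
  4<|π| = subst (4 <_) (sym (length-perm π↭)) 4<n
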